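{- Let $\phi$ be a 3CNF formula with variables $x_1,\ldots,x_n$ and clauses $c_1,\ldots,c_m$, each clause containing exactly three variables, and let $G(\phi)$ be the graph constructed below. If $G(\phi)$ has a Grundy coloring with $10n+10m+1$ colors, then $\phi$ is satisfiable.
   Context: Support operation: given a graph, a vertex $u$ and a set $S$ of positive integers, for each $i\in S$ add a new clique on $i$ new vertices and connect one arbitrary vertex of this clique to $u$. Construction of $G(\phi)$: (1) for each $i\in[n]$ create vertices $x_i^P,x_i^N$ and the edge $x_i^Px_i^N$; (2) support $x_i^P$ and $x_i^N$ each with the set $[2i-2]$ (empty for $i=1$); (3) for each $i\in[n],j\in[m]$ such that $x_i$ appears in $c_j$, create a vertex $x_{i,j}$; if $x_i$ appears positively in $c_j$ connect $x_{i,j}$ to $x_{i'}^P$ for all $i'\in[n]$, otherwise connect $x_{i,j}$ to $x_{i'}^N$ for all $i'\in[n]$; (4) support each such $x_{i,j}$ with the set $(\{2k: k\in[n]\}\cup\{2i-1,2n+1,2n+2\})\setminus\{2i\}$; (5) for each $j\in[m]$ create a vertex $c_j$ adjacent to the (three) vertices $x_{i,j}$ and support $c_j$ with $[2n]$; (6) for each $j\in[m]$ create a vertex $d_j$ adjacent to $c_j$ and support $d_j$ with $[2n+3]\cup[2n+5,2n+3+j]$; (7) create a vertex $u$ adjacent to all $d_j$, $j\in[m]$, and support $u$ with $[2n+4]\cup[2n+5+m,10n+10m]$. Here $[a,b]=\{k: a\le k\le b\}$ and $[a]=[1,a]$. A Grundy coloring with $k$ colors of a graph $(V,E)$ is a partition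 of $V$ into $k$ non-empty independent sets $V_1,\ldots,V_k$ such that for each $i\in[k-1]$ every vertex of $\bigcup_{j>i}V_j$ has a neighbor in $V_i$. -}

module Defs where

open import Data.Nat using (ℕ; zero; suc; _+_; _*_; _∸_; _≤ᵇ_; _≡ᵇ_; _%_)
open import Data.Bool using (Bool; true; false; _∧_; _∨_; not; T)
open import Data.Fin using (Fin; toℕ; _<_)
import Data.Fin as F
open import Data.Product using (Σ; _×_; _,_; proj₁; proj₂; ∃)
open import Data.Sum using (_⊎_)
open import Relation.Binary.PropositionalEquality using (_≡_; _≢_)
open import Level using (0ℓ)

record Graph : Set₁ where
  field
    V   : Set
    Adj : V → V → Set

open Graph public

-- A Grundy coloring with k colors: colours 0,…,k-1 of Fin k stand for
-- the classes V_1,…,V_k.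
record GrundyColoring (G : Graph) (k : ℕ) : Set where
  field
    col      : V G → Fin k
    nonempty : (c : Fin k) → ∃ λ v → col v ≡ c
    proper   : (v w : V G) → Adj G v w → col v ≢ col w
    grundy   : (v : V G) (c : Fin k) → c < col v →
               ∃ λ w → Adj G v w × col w ≡ c

-- A literal: a variable index and a sign (true = positive occurrence).
Literal : ℕ → Set
Literal n = Fin n × Bool

Formula : ℕ → ℕ → Set
Formula n m = Fin m → Fin 3 → Literal n

ThreeVars : ∀ {n m} → Formula n m → Set
ThreeVars {n} {m} φ = (j : Fin m) (p q : Fin 3) → p ≢ q →
  proj₁ (φ j p) ≢ proj₁ (φ j q)

Satisfiable : ∀ {n m} → Formula n m → Set
Satisfiable {n} {m} φ = Σ (Fin n → Bool) λ a →
  (j : Fin m) → ∃ λ (p : Fin 3) → a (proj₁ (φ j p)) ≡ proj₂ (φ j p)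

-- 1-based index of a Fin element
idx : ∀ {k} → Fin k → ℕ
idx i = suc (toℕ i)

inRange : ℕ → ℕ → ℕ → Bool
inRange a b s = (a ≤ᵇ s) ∧ (s ≤ᵇ b)

-- Vertices that get supported ("base" vertices).
-- bx j p is the vertex x_{i,j} for i the variable of the p-th literal of c_j.
data Base (n m : ℕ) : Set where
  bxP bxN : Fin n → Base n m
  bx      : Fin m → Fin 3 → Base n m
  bc bd   : Fin m → Base n m
  bu      : Base n m

supp : ∀ {n m} → Formula n m → Base n m → ℕ → Bool
supp {n} {m} φ (bxP i) s = inRange 1 (2 * idx i ∸ 2) s
supp {n} {m} φ (bxN i) s = inRange 1 (2 * idx i ∸ 2) s
supp {n} {m} φ (bx j p) s =
  let i = idx (proj₁ (φ j p)) in
  ( (inRange 2 (2 * n) s ∧ (s % 2 ≡ᵇ 0))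
    ∨ (s ≡ᵇ 2 * i ∸ 1) ∨ (s ≡ᵇ 2 * n + 1) ∨ (s ≡ᵇ 2 * n + 2) )
  ∧ not (s ≡ᵇ 2 * i)
supp {n} {m} φ (bc j) s = inRange 1 (2 * n) s
supp {n} {m} φ (bd j) s =
  inRange 1 (2 * n + 3) s ∨ inRange (2 * n + 5) (2 * n + 3 + idx j) s
supp {n} {m} φ bu s =
  inRange 1 (2 * n + 4) s ∨ inRange (2 * n + 5 + m) (10 * n + 10 * m) s

-- Vertices: the base vertices and, for every base vertex b and every
-- s in its support set, a clique of s new vertices sup b s _ k (k : Fin s).
data Vertex {n m : ℕ} (φ : Formula n m) : Set where
  base : Base n m → Vertex φ
  sup  : (b : Base n m) (s : ℕ) → T (supp φ b s) → Fin s → Vertex φ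

-- Edge generators (the graph is the symmetric closure).
data Edge {n m : ℕ} (φ : Formula n m) : Vertex φ → Vertex φ → Set where
  e-PN   : (i : Fin n) → Edge φ (base (bxP i)) (base (bxN i))
  e-xP   : (j : Fin m) (p : Fin 3) (i' : Fin n) → proj₂ (φ j p) ≡ true →
           Edge φ (base (bx j p)) (base (bxP i'))
  e-xN   : (j : Fin m) (p : Fin 3) (i' : Fin n) → proj₂ (φ j p) ≡ false →
           Edge φ (base (bx j p)) (base (bxN i'))
  e-cx   : (j : Fin m) (p : Fin 3) → Edge φ (base (bc j)) (base (bx j p))
  e-dc   : (j : Fin m) → Edge φ (base (bd j)) (base (bc j))
  e-ud   : (j : Fin m) → Edge φ (base bu) (base (bd j))
  e-sup  : (b : Base n m) (s : ℕ) (h : T (supp φ b s)) (k : Fin s) →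
           toℕ k ≡ 0 → Edge φ (base b) (sup b s h k)
  e-clq  : (b : Base n m) (s : ℕ) (h : T (supp φ b s)) (k k' : Fin s) →
           k ≢ k' → Edge φ (sup b s h k) (sup b s h k')

G : ∀ {n m} → Formula n m → Graph
G φ = record { V = Vertex φ ; Adj = λ v w → Edge φ v w ⊎ Edge φ w v }

-- A vertex of colour c in a Grundy colouring has a neighbour of every colour below c, so
-- the neighbours of v with colours in a window [t, u) ⊆ [0, colour v) realise u − t distinct
-- colours, and labelling them injectively with fewer than u − t values is a contradiction.
-- Every vertex other than u and its largest support clique has colour below the top colour
-- 10n+10m, which therefore sits on u or on that clique, and u gets colour at least 10n+10m−1.
-- Descending from u, the support sets leave no room at all: d_j gets colour at least 2n+3+j,
-- c_j at least 2n+3 and every x_{i,j} at least 2n, so each clause has an x_{i,j} of colour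
-- exactly 2n+2. The literal vertices x_i^P, x_i^N have colour at most 2i+1, and an x_{i,j} of
-- colour 2n+2 pushes its own literal vertex up to 2i+1. As x_i^P and x_i^N are adjacent,
-- making x_i true iff x_i^P has colour 2i+1 satisfies every clause.
-- (Colours and the variable index i count from 0, the clause index j from 1.)

module Submission where

open import Defs
open import Data.Nat
open import Data.Nat.Properties
open import Data.Nat.DivMod using (_%_; [m+kn]%n≡m%n)
open import Data.Fin using (Fin; toℕ; fromℕ<; punchOut) renaming (zero to fzero)
open import Data.Fin.Properties
  using (toℕ-injective; toℕ<n; toℕ-fromℕ<; fromℕ<-injective; punchOut-injective; injective⇒≤)
open import Data.Bool using (Bool; true; false; _∧_; _∨_; not; T)
open import Data.Bool.Properties using (T-∧; T-∨; T-not-≡; T-irrelevant)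
open import Data.Product using (Σ; _×_; _,_; proj₁; proj₂; ∃; ∃₂; uncurry)
open import Data.Sum using (_⊎_; inj₁; inj₂; [_,_]′)
open import Data.Vec using (Vec; lookup; map; allFin; allPairs; _++_; [_])
open import Data.Vec.Relation.Unary.Any using (index; here)
open import Data.Vec.Relation.Unary.Any.Properties using (lookup-index)
open import Data.Vec.Membership.Propositional using (_∈_)
open import Data.Vec.Membership.Propositional.Properties
  using (∈-map⁺; ∈-++⁺ˡ; ∈-++⁺ʳ; ∈-allFin⁺; ∈-allPairs⁺)
open import Function using (_∘_; Equivalence)
open import Relation.Binary.PropositionalEquality hiding ([_])
open import Relation.Nullary using (yes; no; does)
open import Relation.Nullary.Decidable using (dec-true; dec-false)
open import Data.Empty using (⊥-elim)
open import Data.Nat.Tactic.RingSolver using (solve-∀)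

module GrundyWindows {G : Graph} {k : ℕ} (gc : GrundyColoring G k) where
  open GrundyColoring gc

  colour : V G → ℕ
  colour v = toℕ (col v)

  neighbour-of-colour : ∀ v {c} → c < colour v → ∃ λ w → Adj G v w × colour w ≡ c
  neighbour-of-colour v {c} c<v =
    let c<k = <-trans c<v (toℕ<n (col v))
        (w , v~w , col-w≡c) = grundy v (fromℕ< c<k) (subst (_< colour v) (sym (toℕ-fromℕ< c<k)) c<v)
    in w , v~w , trans (cong toℕ col-w≡c) (toℕ-fromℕ< c<k)

  InWindow : V G → ℕ → ℕ → V G → Set
  InWindow v t u w = Adj G v w × t ≤ colour w × colour w < u

  Separating : ∀ {v t u} {A : Set} → (∀ w → InWindow v t u w → A) → Set
  Separating {v} {t} {u} g =
    ∀ {w w'} (p : InWindow v t u w) (p' : InWindow v t u w') → g w p ≡ g w' p' → colour w ≡ colour w'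

  private
    +-<-∸ : ∀ t {i u} → i < u ∸ t → t + i < u
    +-<-∸ zero    i<u = i<u
    +-<-∸ (suc t) {u = suc u} i<u = s≤s (+-<-∸ t i<u)

  window-injection : ∀ {v t u M} → u ≤ colour v →
    (g : ∀ w → InWindow v t u w → Fin M) → Separating g → u ∸ t ≤ M
  window-injection {v} {t} {u} u≤v g g-separates =
    injective⇒≤ {f = λ i → g _ (in-window i)} f-injective
    where
    witness : (i : Fin (u ∸ t)) → ∃ λ w → Adj G v w × colour w ≡ t + toℕ i
    witness i = neighbour-of-colour v (<-≤-trans (+-<-∸ t (toℕ<n i)) u≤v)

    in-window : (i : Fin (u ∸ t)) → InWindow v t u (proj₁ (witness i))
    in-window i =
      let (_ , v~w , col≡) = witness i
      in v~w , subst (t ≤_) (sym col≡) (m≤m+n t _) , subst (_< u) (sym col≡) (+-<-∸ t (toℕ<n i))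

    f-injective : ∀ {i j} → g _ (in-window i) ≡ g _ (in-window j) → i ≡ j
    f-injective {i} {j} eq = toℕ-injective (+-cancelˡ-≡ t _ _ (begin
      t + toℕ i                  ≡⟨ sym (proj₂ (proj₂ (witness i))) ⟩
      colour (proj₁ (witness i)) ≡⟨ g-separates (in-window i) (in-window j) eq ⟩
      colour (proj₁ (witness j)) ≡⟨ proj₂ (proj₂ (witness j)) ⟩
      t + toℕ j                  ∎))
      where open ≡-Reasoning

  window-injection-avoiding : ∀ {v t u M} → u ≤ colour v →
    (g : ∀ w → InWindow v t u w → Fin M) (e : Fin M) → (∀ w p → g w p ≢ e) → Separating g →
    u ∸ t < M
  window-injection-avoiding {M = suc M} u≤v g e g≢e g-separates =
    s≤s (window-injection u≤v (λ w p → punchOut (g≢e w p ∘ sym))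
        (λ {w} {w'} p p' eq →
        g-separates p p' (punchOut-injective (g≢e w p ∘ sym) (g≢e w' p' ∘ sym) eq)))

  window-labels : ∀ {v t u lo hi e} → u ≤ colour v → lo ≤ e → e < hi →
    (label : V G → ℕ) →
    (∀ {w} → InWindow v t u w → lo ≤ label w × label w < hi × label w ≢ e) →
    Separating {v} {t} {u} (λ w _ → label w) → u ∸ t < hi ∸ lo
  window-labels {lo = lo} {hi} {e} u≤v lo≤e e<hi label bounded separates =
    window-injection-avoiding u≤v g (fromℕ< (∸-monoˡ-< e<hi lo≤e)) g≢e
      (λ p p' eq → separates p p' (label-injective p p' eq))
    where
    g : ∀ w → InWindow _ _ _ w → Fin (hi ∸ lo)
    g w p with bounded p
    ... | lo≤ , <hi , _ = fromℕ< (∸-monoˡ-< <hi lo≤)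

    label-injective : ∀ {w w'} p p' → g w p ≡ g w' p' → label w ≡ label w'
    label-injective p p' eq with bounded p | bounded p'
    ... | lo≤ , _ , _ | lo≤' , _ , _ = ∸-cancelʳ-≡ lo≤ lo≤' (fromℕ<-injective _ _ _ _ eq)

    g≢e : ∀ w p → g w p ≢ fromℕ< (∸-monoˡ-< e<hi lo≤e)
    g≢e w p eq with bounded p
    ... | lo≤ , _ , ≢e = ≢e (∸-cancelʳ-≡ lo≤ lo≤e (fromℕ<-injective _ _ _ _ eq))

  window-⊆ : ∀ {v t u L} → u ≤ colour v → (xs : Vec (V G) L) →
    (∀ {w} → InWindow v t u w → w ∈ xs) → u ∸ t ≤ L
  window-⊆ u≤v xs covers = window-injection u≤v (λ _ → index ∘ covers) λ p p' eq →
    cong colour (trans (lookup-index (covers p))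
                       (trans (cong (lookup xs) eq) (sym (lookup-index (covers p')))))

literal : ∀ {n m} → Bool → Fin n → Base n m
literal true  = bxP
literal false = bxN

module Construction {n m : ℕ} (φ : Formula n m) where

  infix 4 _~_
  _~_ : Vertex φ → Vertex φ → Set
  v ~ w = Adj (G φ) v w

  data Attached (b : Base n m) : Vertex φ → Set where
    attached : ∀ {s} (h : T (supp φ b s)) (k : Fin s) → toℕ k ≡ 0 → Attached b (sup b s h k)

  size : ∀ {b w} → Attached b w → ℕ
  size (attached {s} _ _ _) = s

  attached-unique : ∀ {b w w'} (a : Attached b w) (a' : Attached b w') → size a ≡ size a' → w ≡ w'
  attached-unique (attached h k k≡0) (attached h' k' k'≡0) refl
    rewrite T-irrelevant h h' | toℕ-injective {i = k} {j = k'} (trans k≡0 (sym k'≡0)) = refl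

  clique-neighbour : ∀ {b s h k w} → sup b s h k ~ w →
    (∃ λ k' → k' ≢ k × w ≡ sup b s h k') ⊎ (toℕ k ≡ 0 × w ≡ base b)
  clique-neighbour (inj₁ (e-clq b s h k k' k≢k')) = inj₁ (k' , k≢k' ∘ sym , refl)
  clique-neighbour (inj₂ (e-clq b s h k' k k'≢k)) = inj₁ (k' , k'≢k , refl)
  clique-neighbour (inj₂ (e-sup b s h k k≡0))     = inj₂ (k≡0 , refl)

  base-neighbour : ∀ {b w} → base b ~ w → (∃ λ b' → w ≡ base b') ⊎ Attached b w
  base-neighbour (inj₁ (e-sup _ s h k k≡0)) = inj₂ (attached h k k≡0)
  base-neighbour (inj₁ (e-PN _))            = inj₁ (_ , refl)
  base-neighbour (inj₁ (e-xP _ _ _ _))      = inj₁ (_ , refl)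
  base-neighbour (inj₁ (e-xN _ _ _ _))      = inj₁ (_ , refl)
  base-neighbour (inj₁ (e-cx _ _))          = inj₁ (_ , refl)
  base-neighbour (inj₁ (e-dc _))            = inj₁ (_ , refl)
  base-neighbour (inj₁ (e-ud _))            = inj₁ (_ , refl)
  base-neighbour (inj₂ (e-PN _))            = inj₁ (_ , refl)
  base-neighbour (inj₂ (e-xP _ _ _ _))      = inj₁ (_ , refl)
  base-neighbour (inj₂ (e-xN _ _ _ _))      = inj₁ (_ , refl)
  base-neighbour (inj₂ (e-cx _ _))          = inj₁ (_ , refl)
  base-neighbour (inj₂ (e-dc _))            = inj₁ (_ , refl)
  base-neighbour (inj₂ (e-ud _))            = inj₁ (_ , refl)

  u-neighbour : ∀ {w} → base bu ~ w → (∃ λ j → w ≡ base (bd j)) ⊎ Attached bu w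
  u-neighbour (inj₁ (e-ud j))              = inj₁ (j , refl)
  u-neighbour (inj₁ (e-sup _ s h k k≡0))   = inj₂ (attached h k k≡0)

  d-neighbour : ∀ {j w} → base (bd j) ~ w → w ≡ base bu ⊎ w ≡ base (bc j) ⊎ Attached (bd j) w
  d-neighbour (inj₂ (e-ud j))              = inj₁ refl
  d-neighbour (inj₁ (e-dc j))              = inj₂ (inj₁ refl)
  d-neighbour (inj₁ (e-sup _ s h k k≡0))   = inj₂ (inj₂ (attached h k k≡0))

  c-neighbour : ∀ {j w} → base (bc j) ~ w →
    w ≡ base (bd j) ⊎ (∃ λ p → w ≡ base (bx j p)) ⊎ Attached (bc j) w
  c-neighbour (inj₂ (e-dc j))              = inj₁ refl
  c-neighbour (inj₁ (e-cx j p))            = inj₂ (inj₁ (p , refl))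
  c-neighbour (inj₁ (e-sup _ s h k k≡0))   = inj₂ (inj₂ (attached h k k≡0))

  x-neighbour : ∀ {j p w} → base (bx j p) ~ w →
    w ≡ base (bc j) ⊎ (∃ λ i → w ≡ base (literal (proj₂ (φ j p)) i)) ⊎ Attached (bx j p) w
  x-neighbour (inj₂ (e-cx j p))                         = inj₁ refl
  x-neighbour (inj₁ (e-xP j p i positive)) rewrite positive = inj₂ (inj₁ (i , refl))
  x-neighbour (inj₁ (e-xN j p i negative)) rewrite negative = inj₂ (inj₁ (i , refl))
  x-neighbour (inj₁ (e-sup _ s h k k≡0))                = inj₂ (inj₂ (attached h k k≡0))

  literal-neighbour : ∀ σ i {w} → base (literal σ i) ~ w →
    w ≡ base (literal (not σ) i) ⊎ (∃₂ λ j p → w ≡ base (bx j p)) ⊎ Attached (literal σ i) w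
  literal-neighbour true  i (inj₁ (e-PN i))              = inj₁ refl
  literal-neighbour false i (inj₂ (e-PN i))              = inj₁ refl
  literal-neighbour true  i (inj₂ (e-xP j p i _))        = inj₂ (inj₁ (j , p , refl))
  literal-neighbour false i (inj₂ (e-xN j p i _))        = inj₂ (inj₁ (j , p , refl))
  literal-neighbour true  i (inj₁ (e-sup _ s h k k≡0))   = inj₂ (inj₂ (attached h k k≡0))
  literal-neighbour false i (inj₁ (e-sup _ s h k k≡0))   = inj₂ (inj₂ (attached h k k≡0))

  private
    every : ∀ {k} → (Fin k → Base n m) → Vec (Base n m) k
    every f = map f (allFin _)

    ∈-every : ∀ {k} (f : Fin k → Base n m) i → f i ∈ every f
    ∈-every f i = ∈-map⁺ f (∈-allFin⁺ i)

    occurrences : Vec (Base n m) (m * 3)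
    occurrences = map (uncurry bx) (allPairs (allFin m) (allFin 3))

  allBase : Vec (Base n m) (n + (n + (m * 3 + (m + (m + 1)))))
  allBase = every bxP ++ every bxN ++ occurrences ++ every bc ++ every bd ++ [ bu ]

  ∈-allBase : ∀ b → b ∈ allBase
  ∈-allBase (bxP i)  = ∈-++⁺ˡ (∈-every bxP i)
  ∈-allBase (bxN i)  = ∈-++⁺ʳ (every bxP) (∈-++⁺ˡ (∈-every bxN i))
  ∈-allBase (bx j p) = ∈-++⁺ʳ (every bxP) (∈-++⁺ʳ (every bxN) (∈-++⁺ˡ
                         (∈-map⁺ (uncurry bx) (∈-allPairs⁺ (∈-allFin⁺ j) (∈-allFin⁺ p)))))
  ∈-allBase (bc j)   = ∈-++⁺ʳ (every bxP) (∈-++⁺ʳ (every bxN) (∈-++⁺ʳ occurrences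
                         (∈-++⁺ˡ (∈-every bc j))))
  ∈-allBase (bd j)   = ∈-++⁺ʳ (every bxP) (∈-++⁺ʳ (every bxN) (∈-++⁺ʳ occurrences
                         (∈-++⁺ʳ (every bc) (∈-++⁺ˡ (∈-every bd j)))))
  ∈-allBase bu       = ∈-++⁺ʳ (every bxP) (∈-++⁺ʳ (every bxN) (∈-++⁺ʳ occurrences
                         (∈-++⁺ʳ (every bc) (∈-++⁺ʳ (every bd) (here refl)))))

  -- The vertex k is not its own neighbour, so its index is free to label the base vertex.
  clique-label : ∀ {s} → Fin s → Vertex φ → ℕ
  clique-label k (sup _ _ _ k') = toℕ k'
  clique-label k (base _)       = toℕ k

  clique-label<size : ∀ {b s h k w} → sup b s h k ~ w → clique-label k w < s
  clique-label<size v~w with clique-neighbour v~w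
  ... | inj₁ (k' , _ , refl) = toℕ<n k'
  ... | inj₂ (_ , refl)      = toℕ<n _

  clique-label-separates : ∀ {b s h k w w'} → sup b s h k ~ w → sup b s h k ~ w' →
    clique-label k w ≡ clique-label k w' → w ≡ w'
  clique-label-separates v~w v~w' eq with clique-neighbour v~w | clique-neighbour v~w'
  ... | inj₁ (_ , _ , refl)     | inj₁ (_ , _ , refl)     = cong (sup _ _ _) (toℕ-injective eq)
  ... | inj₁ (_ , k₁≢k , refl)  | inj₂ (_ , refl)         = ⊥-elim (k₁≢k (toℕ-injective eq))
  ... | inj₂ (_ , refl)         | inj₁ (_ , k₂≢k , refl)  = ⊥-elim (k₂≢k (toℕ-injective (sym eq)))
  ... | inj₂ (_ , refl)         | inj₂ (_ , refl)         = refl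

  private
    inRange⇒ : ∀ {a b s} → T (inRange a b s) → a ≤ s × s ≤ b
    inRange⇒ {a} {b} {s} h =
      let (a≤s , s≤b) = Equivalence.to (T-∧ {a ≤ᵇ s}) h in ≤ᵇ⇒≤ a s a≤s , ≤ᵇ⇒≤ s b s≤b

    2*idx : ∀ {k} (i : Fin k) → 2 * idx i ≡ 2 + 2 * toℕ i
    2*idx i = *-suc 2 (toℕ i)

    odd%2 : ∀ a → suc (2 * a) % 2 ≡ 1
    odd%2 a = trans (cong (λ x → suc x % 2) (*-comm 2 a)) ([m+kn]%n≡m%n 1 a 2)

  supp-u : ∀ {s} → T (supp φ bu s) → s ≤ 2 * n + 4 ⊎ (2 * n + 5 + m ≤ s × s ≤ 10 * n + 10 * m)
  supp-u {s} h with Equivalence.to (T-∨ {inRange 1 (2 * n + 4) s}) h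
  ... | inj₁ low  = inj₁ (proj₂ (inRange⇒ low))
  ... | inj₂ high = inj₂ (inRange⇒ high)

  supp-d : ∀ {j s} → T (supp φ (bd j) s) → s ≤ 2 * n + 3 + idx j × s ≢ 2 * n + 4
  supp-d {j} {s} h with Equivalence.to (T-∨ {inRange 1 (2 * n + 3) s}) h
  ... | inj₁ low  = let s≤ = proj₂ (inRange⇒ low) in
    ≤-trans s≤ (m≤m+n _ (idx j)) , <⇒≢ (≤-trans (s≤s s≤) (≤-reflexive (sym (+-suc (2 * n) 3))))
  ... | inj₂ high = let (≤s , s≤) = inRange⇒ high in
    s≤ , (<⇒≢ (≤-trans (≤-reflexive (sym (+-suc (2 * n) 4))) ≤s)) ∘ sym

  supp-c : ∀ {j s} → T (supp φ (bc j) s) → s ≤ 2 * n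
  supp-c = proj₂ ∘ inRange⇒

  supp-literal : ∀ σ i {s} → T (supp φ (literal σ i) s) → s ≤ 2 * toℕ i
  supp-literal true  i {s} h = subst (s ≤_) (cong (_∸ 2) (2*idx i)) (proj₂ (inRange⇒ {1} h))
  supp-literal false i {s} h = subst (s ≤_) (cong (_∸ 2) (2*idx i)) (proj₂ (inRange⇒ {1} h))

  supp-x : ∀ {j p s} → T (supp φ (bx j p) s) →
    s ≤ 2 * n + 2 × s ≢ 2 * idx (proj₁ (φ j p)) ×
    (∀ a → s ≡ suc (2 * a) → a ≡ toℕ (proj₁ (φ j p)) ⊎ a ≡ n)
  supp-x {j} {p} {s} h = bound , ≢2i , odd
    where
    i = proj₁ (φ j p)
    t = toℕ i
    even-range = inRange 2 (2 * n) s ∧ (s % 2 ≡ᵇ 0)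
    odd-i      = s ≡ᵇ 2 * idx i ∸ 1
    odd-n      = s ≡ᵇ 2 * n + 1
    even-n     = s ≡ᵇ 2 * n + 2
    split = Equivalence.to (T-∧ {even-range ∨ odd-i ∨ odd-n ∨ even-n}) h

    ≢2i : s ≢ 2 * idx i
    ≢2i s≡ = subst T (Equivalence.to (T-not-≡ {s ≡ᵇ 2 * idx i}) (proj₂ split)) (≡⇒≡ᵇ s _ s≡)

    alternatives : (s ≤ 2 * n × s % 2 ≡ 0) ⊎ s ≡ suc (2 * t) ⊎ s ≡ 2 * n + 1 ⊎ s ≡ 2 * n + 2
    alternatives with Equivalence.to (T-∨ {even-range}) (proj₁ split)
    ... | inj₁ a = let (range , even) = Equivalence.to (T-∧ {inRange 2 (2 * n) s}) a in
                   inj₁ (proj₂ (inRange⇒ range) , ≡ᵇ⇒≡ _ 0 even)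
    ... | inj₂ bcd with Equivalence.to (T-∨ {odd-i}) bcd
    ... | inj₁ b = inj₂ (inj₁ (trans (≡ᵇ⇒≡ s _ b) (cong (_∸ 1) (2*idx i))))
    ... | inj₂ cd with Equivalence.to (T-∨ {odd-n}) cd
    ... | inj₁ c = inj₂ (inj₂ (inj₁ (≡ᵇ⇒≡ s _ c)))
    ... | inj₂ d = inj₂ (inj₂ (inj₂ (≡ᵇ⇒≡ s _ d)))

    bound : s ≤ 2 * n + 2
    bound with alternatives
    ... | inj₁ (s≤2n , _)         = ≤-trans s≤2n (m≤m+n _ 2)
    ... | inj₂ (inj₁ refl)        = ≤-trans (n≤1+n _) (≤-trans (≤-reflexive (+-comm 2 (2 * t)))
                                      (+-monoˡ-≤ 2 (*-monoʳ-≤ 2 (<⇒≤ (toℕ<n i)))))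
    ... | inj₂ (inj₂ (inj₁ refl)) = +-monoʳ-≤ (2 * n) (n≤1+n 1)
    ... | inj₂ (inj₂ (inj₂ refl)) = ≤-refl

    odd : ∀ a → s ≡ suc (2 * a) → a ≡ t ⊎ a ≡ n
    odd a s≡ with alternatives
    ... | inj₁ (_ , even)         = ⊥-elim (0≢1+n (trans (sym even) (trans (cong (_% 2) s≡) (odd%2 a))))
    ... | inj₂ (inj₁ refl)        = inj₁ (*-cancelˡ-≡ a t 2 (suc-injective (sym s≡)))
    ... | inj₂ (inj₂ (inj₁ refl)) =
      inj₂ (*-cancelˡ-≡ a n 2 (suc-injective (trans (sym s≡) (+-comm (2 * n) 1))))
    ... | inj₂ (inj₂ (inj₂ refl)) =
      ⊥-elim (even≢odd (suc n) a (trans (trans (*-suc 2 n) (+-comm 2 (2 * n))) s≡))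

  private
    2n≤ : 2 * n ≤ 2 * n + 3 + m
    2n≤ = ≤-trans (m≤m+n (2 * n) 3) (m≤m+n _ m)

    2i≤ : ∀ (i : Fin n) → 2 * toℕ i ≤ 2 * n + 3 + m
    2i≤ i = ≤-trans (*-monoʳ-≤ 2 (<⇒≤ (toℕ<n i))) 2n≤

  supp-≤ : ∀ {b s} → b ≢ bu → T (supp φ b s) → s ≤ 2 * n + 3 + m
  supp-≤ {bxP i}  _     h = ≤-trans (supp-literal true i h) (2i≤ i)
  supp-≤ {bxN i}  _     h = ≤-trans (supp-literal false i h) (2i≤ i)
  supp-≤ {bx j p} _     h =
    ≤-trans (proj₁ (supp-x h)) (≤-trans (+-monoʳ-≤ (2 * n) (n≤1+n 2)) (m≤m+n _ m))
  supp-≤ {bc j}   _     h = ≤-trans (supp-c {j} h) 2n≤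
  supp-≤ {bd j}   _     h = ≤-trans (proj₁ (supp-d h)) (+-monoʳ-≤ (2 * n + 3) (toℕ<n j))
  supp-≤ {bu}     b≢bu  _ = ⊥-elim (b≢bu refl)

module Colouring (n' m' : ℕ) (φ : Formula (suc n') (suc m'))
                 (gc : GrundyColoring (G φ) (10 * suc n' + 10 * suc m' + 1)) where
  open Construction φ
  open GrundyWindows gc
  open GrundyColoring gc using (nonempty; proper)

  n m top : ℕ
  n   = suc n'
  m   = suc m'
  top = 10 * n + 10 * m

  private
    budget : 2 * n + 3 + m + (n + (n + (m * 3 + (m + (m + 1))))) < top
    budget = subst (suc (2 * n + 3 + m + (n + (n + (m * 3 + (m + (m + 1)))))) ≤_) (eq n' m')
                   (m≤m+n _ (5 + 6 * n' + 4 * m'))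
      where
      eq : ∀ x y → suc (2 * suc x + 3 + suc y + (suc x + (suc x + (suc y * 3 + (suc y + (suc y + 1))))))
                     + (5 + 6 * x + 4 * y) ≡ 10 * suc x + 10 * suc y
      eq = solve-∀

    d-room : suc (suc (2 * n + 3 + m)) ≤ top
    d-room = subst (suc (suc (2 * n + 3 + m)) ≤_) (eq n' m') (m≤m+n _ (12 + 8 * n' + 9 * m'))
      where
      eq : ∀ x y → suc (suc (2 * suc x + 3 + suc y)) + (12 + 8 * x + 9 * y) ≡ 10 * suc x + 10 * suc y
      eq = solve-∀

    support<top : 2 * n + 3 + m < top
    support<top = ≤-trans (s≤s (m≤m+n _ _)) budget

    2n+4≤d-index : ∀ (j : Fin m) → 2 * n + 4 ≤ 2 * n + 3 + idx j
    2n+4≤d-index j = ≤-trans (≤-reflexive (+-suc (2 * n) 3)) (m<m+n (2 * n + 3) (s≤s z≤n))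

    d-index-injective : ∀ {j j' : Fin m} → suc (2 * n + 3 + idx j) ≡ suc (2 * n + 3 + idx j') → j ≡ j'
    d-index-injective eq = toℕ-injective (suc-injective (+-cancelˡ-≡ (2 * n + 3) _ _ (suc-injective eq)))

    2i+2≤2n : ∀ (i : Fin n) → 2 + 2 * toℕ i ≤ 2 * n
    2i+2≤2n i = subst (_≤ 2 * n) (*-suc 2 (toℕ i)) (*-monoʳ-≤ 2 (toℕ<n i))

    2n+2<2n+3 : 2 * n + 2 < 2 * n + 3
    2n+2<2n+3 = +-monoʳ-< (2 * n) ≤-refl

    u-or-other : (b : Base n m) → b ≡ bu ⊎ b ≢ bu
    u-or-other bu       = inj₁ refl
    u-or-other (bxP _)  = inj₂ λ ()
    u-or-other (bxN _)  = inj₂ λ ()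
    u-or-other (bx _ _) = inj₂ λ ()
    u-or-other (bc _)   = inj₂ λ ()
    u-or-other (bd _)   = inj₂ λ ()

  d-index<pred-top : ∀ j → 2 * n + 3 + idx j < pred top
  d-index<pred-top j = ≤-trans (s≤s (+-monoʳ-≤ (2 * n + 3) (toℕ<n j))) (≤-pred d-room)

  supp-u≤top : ∀ {s} → T (supp φ bu s) → s ≤ top
  supp-u≤top h with supp-u h
  ... | inj₁ s≤       = ≤-trans s≤ (≤-trans (≤-reflexive (+-suc (2 * n) 3))
                          (≤-trans (m<m+n (2 * n + 3) (s≤s z≤n)) (<⇒≤ support<top)))
  ... | inj₂ (_ , s≤) = s≤

  u-supp-avoids-d : ∀ j {s} → T (supp φ bu s) → s ≢ suc (2 * n + 3 + idx j)
  u-supp-avoids-d j h with supp-u h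
  ... | inj₁ s≤          = <⇒≢ (≤-<-trans s≤ (s≤s (2n+4≤d-index j)))
  ... | inj₂ (low≤s , _) =
    (<⇒≢ (≤-trans (s≤s (s≤s (+-monoʳ-≤ (2 * n + 3) (toℕ<n j))))
                  (≤-trans (≤-reflexive 2n+5+m≡) low≤s))) ∘ sym
    where
    2n+5+m≡ : suc (suc (2 * n + 3 + m)) ≡ 2 * n + 5 + m
    2n+5+m≡ = cong (_+ m) (sym (trans (+-suc (2 * n) 4) (cong suc (+-suc (2 * n) 3))))

  clique-label-separating : ∀ {b s h k t u} → Separating {sup b s h k} {t} {u} (λ w _ → clique-label k w)
  clique-label-separating (v~w , _) (v~w' , _) eq = cong colour (clique-label-separates v~w v~w' eq)

  clique-colour≤size : ∀ b s h k → colour (sup b s h k) ≤ s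
  clique-colour≤size b s h k =
    ≤-pred (window-labels {v = sup b s h k} {t = 0} ≤-refl z≤n (n<1+n s) (clique-label k)
      (λ (v~w , _) → let lt = clique-label<size v~w in z≤n , m<n⇒m<1+n lt , <⇒≢ lt)
      clique-label-separating)

  clique-colour<size : ∀ {b s h k} → toℕ k ≢ 0 ⊎ colour (sup b s h k) ≤ colour (base b) →
    colour (sup b s h k) < s
  clique-colour<size {b} {s} {h} {k} base-excluded =
    window-labels ≤-refl z≤n (toℕ<n k) (clique-label k) bounded clique-label-separating
    where
    v = sup b s h k
    bounded : ∀ {w} → InWindow v 0 (colour v) w →
      0 ≤ clique-label k w × clique-label k w < s × clique-label k w ≢ toℕ k
    bounded (v~w , _ , w<v) with clique-neighbour v~w
    ... | inj₁ (k' , k'≢k , refl) = z≤n , toℕ<n k' , k'≢k ∘ toℕ-injective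
    ... | inj₂ (k≡0 , refl)       = ⊥-elim ([ (λ k≢0 → k≢0 k≡0) , <⇒≱ w<v ]′ base-excluded)

  attached-colour<size : ∀ {b w} (a : Attached b w) → colour w < colour (base b) → colour w < size a
  attached-colour<size (attached _ _ _) w<b = clique-colour<size (inj₂ (<⇒≤ w<b))

  -- Above the largest support size only base neighbours contribute colours.
  base-colour<top : ∀ {b} → b ≢ bu → colour (base b) < top
  base-colour<top {b} b≢bu = ≤-<-trans (≤-trans (m≤n+m∸n _ bound)
    (+-monoʳ-≤ bound (window-⊆ ≤-refl (map base allBase) covers))) budget
    where
    bound = 2 * n + 3 + m
    covers : ∀ {w} → InWindow (base b) bound (colour (base b)) w → w ∈ map base allBase
    covers (v~w , bound≤w , w<v) with base-neighbour v~w
    ... | inj₁ (b' , refl)        = ∈-map⁺ base (∈-allBase b')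
    ... | inj₂ a@(attached h _ _) =
      ⊥-elim (<⇒≱ (<-≤-trans (attached-colour<size a w<v) (supp-≤ b≢bu h)) bound≤w)

  top-vertex : ∃ λ z → colour z ≡ top
  top-vertex = let (z , col≡) = nonempty (fromℕ< top<) in z , trans (cong toℕ col≡) (toℕ-fromℕ< top<)
    where
    top< : top < top + 1
    top< = m<m+n top (s≤s z≤n)

  top-holder : ∀ z → colour z ≡ top → z ≡ base bu ⊎ Σ (Attached bu z) (λ a → size a ≡ top)
  top-holder (base b) z-top with u-or-other b
  ... | inj₁ refl = inj₁ refl
  ... | inj₂ b≢bu = ⊥-elim (<-irrefl z-top (base-colour<top b≢bu))
  top-holder (sup b s h k) z-top with subst (_≤ s) z-top (clique-colour≤size b s h k) | u-or-other b
  ... | top≤s | inj₂ b≢bu = ⊥-elim (<⇒≱ (≤-<-trans (supp-≤ b≢bu h) support<top) top≤s)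
  ... | top≤s | inj₁ refl with toℕ k ≟ 0
  ... | yes k≡0 = inj₂ (attached h k k≡0 , ≤-antisym (supp-u≤top h) top≤s)
  ... | no k≢0  =
    ⊥-elim (<⇒≱ (clique-colour<size (inj₁ k≢0)) (≤-trans (supp-u≤top h) (≤-reflexive (sym z-top))))

  no-second-top : ∀ {h} {k k' : Fin top} → toℕ k ≡ 0 → colour (sup bu top h k) ≡ top → k' ≢ k →
    colour (sup bu top h k') ≢ pred top
  no-second-top {h} {k} {k'} k≡0 k-top k'≢k k'-second = <-irrefl k'-second
    (window-labels ≤-refl (n≢0⇒n>0 k'≢0) (toℕ<n k') (clique-label k') bounded clique-label-separating)
    where
    y = sup bu top h k'
    k'≢0 : toℕ k' ≢ 0
    k'≢0 k'≡0 = k'≢k (toℕ-injective (trans k'≡0 (sym k≡0)))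
    bounded : ∀ {w} → InWindow y 0 (colour y) w →
      1 ≤ clique-label k' w × clique-label k' w < top × clique-label k' w ≢ toℕ k'
    bounded (y~w , _ , w<y) with clique-neighbour y~w
    ... | inj₂ (k'≡0 , refl)         = ⊥-elim (k'≢0 k'≡0)
    ... | inj₁ (k'' , k''≢k' , refl) = n≢0⇒n>0 k''≢0 , toℕ<n k'' , k''≢k' ∘ toℕ-injective
      where
      k''≢0 : toℕ k'' ≢ 0
      k''≢0 k''≡0 =
        <-irrefl (subst (λ r → colour (sup bu top h r) ≡ top)
                        (toℕ-injective (trans k≡0 (sym k''≡0))) k-top)
                 (<-trans (<-≤-trans w<y (≤-reflexive k'-second)) (n<1+n (pred top)))

  u-near-top : pred top ≤ colour (base bu)
  u-near-top with top-vertex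
  ... | z , z-top with top-holder z z-top
  ... | inj₁ refl = ≤-trans (n≤1+n (pred top)) (≤-reflexive (sym z-top))
  ... | inj₂ (attached h k k≡0 , refl)
    with neighbour-of-colour z (subst (pred top <_) (sym z-top) (n<1+n (pred top)))
  ...   | w , z~w , w-second with clique-neighbour z~w
  ...     | inj₂ (_ , refl)         = ≤-reflexive (sym w-second)
  ...     | inj₁ (k' , k'≢k , refl) = ⊥-elim (no-second-top k≡0 z-top k'≢k w-second)

  full-top-clique : ∀ {w} → colour (base bu) < top → (a : Attached bu w) → size a ≡ top →
    colour w ≡ top
  full-top-clique u<top a a-top with top-vertex
  ... | z , z-top with top-holder z z-top
  ... | inj₁ refl          = ⊥-elim (<-irrefl z-top u<top)
  ... | inj₂ (a' , a'-top) =
    subst (λ r → colour r ≡ top) (attached-unique a' a (trans a'-top (sym a-top))) z-top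

  u-support≤colour : ∀ {w} (a : Attached bu w) → colour w < colour (base bu) → size a ≤ colour (base bu)
  u-support≤colour a@(attached h _ _) w<u = ≮⇒≥ λ u<s →
    let s≤top = supp-u≤top h
        u<top = <-≤-trans u<s s≤top
    in <-irrefl (full-top-clique u<top a (≤-antisym s≤top (≤-trans (s≤s u-near-top) u<s)))
                (<-trans w<u u<top)

  d-colour≤ : ∀ j → colour (base (bd j)) < colour (base bu) → colour (base (bd j)) ≤ 2 * n + 3 + idx j
  d-colour≤ j d<u = ≤-pred (window-labels {v = d} {t = 0} ≤-refl z≤n (s≤s z≤n) label bounded separates)
    where
    d = base (bd j)
    label : Vertex φ → ℕ
    label (base (bc _)) = 2 * n + 4   -- the one size missing from the support set of d_j
    label (sup _ s _ _) = s
    label _             = 0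
    below : ∀ {w} → InWindow d 0 (colour d) w → w ≡ base (bc j) ⊎ Attached (bd j) w
    below (d~w , _ , w<d) with d-neighbour d~w
    ... | inj₁ refl         = ⊥-elim (<-asym d<u w<d)
    ... | inj₂ c-or-support = c-or-support
    bounded : ∀ {w} → InWindow d 0 (colour d) w →
      0 ≤ label w × label w < suc (2 * n + 3 + idx j) × label w ≢ 0
    bounded p with below p
    ... | inj₁ refl             = z≤n , s≤s (2n+4≤d-index j) , λ ()
    ... | inj₂ (attached h k _) = z≤n , s≤s (proj₁ (supp-d h)) , m<n⇒n≢0 (toℕ<n k)
    separates : Separating {d} {0} {colour d} (λ w _ → label w)
    separates p p' eq with below p | below p'
    ... | inj₁ refl               | inj₁ refl                = refl
    ... | inj₁ refl               | inj₂ (attached h _ _)    = ⊥-elim (proj₂ (supp-d h) (sym eq))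
    ... | inj₂ (attached h _ _)   | inj₁ refl                = ⊥-elim (proj₂ (supp-d h) eq)
    ... | inj₂ a@(attached _ _ _) | inj₂ a'@(attached _ _ _) = cong colour (attached-unique a a' eq)

  d-colour≥ : ∀ j → 2 * n + 3 + idx j ≤ colour (base (bd j))
  d-colour≥ j = ≮⇒≥ λ d<t → <-irrefl refl
    (window-labels {v = u} {t = t} ≤-refl ≤-refl (s≤s (<-≤-trans (d-index<pred-top j) u-near-top)) label
      (bounded d<t) separates)
    where
    t = 2 * n + 3 + idx j
    u = base bu
    label : Vertex φ → ℕ
    label (base (bd j')) = suc (2 * n + 3 + idx j')   -- sizes missing from the support set of u
    label (sup _ s _ _)  = s
    label _              = 0
    bounded : colour (base (bd j)) < t → ∀ {w} → InWindow u t (colour u) w →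
      suc t ≤ label w × label w < suc (colour u) × label w ≢ suc t
    bounded d<t (u~w , t≤w , w<u) with u-neighbour u~w
    ... | inj₁ (j' , refl) =
      s≤s (≤-trans t≤w (d-colour≤ j' w<u)) , s≤s (<-≤-trans (d-index<pred-top j') u-near-top) ,
      λ eq → <⇒≱ d<t (subst (λ r → t ≤ colour (base (bd r))) (d-index-injective eq) t≤w)
    ... | inj₂ a@(attached h _ _) =
      ≤-<-trans t≤w (attached-colour<size a w<u) , s≤s (u-support≤colour a w<u) , u-supp-avoids-d j h
    separates : Separating {u} {t} {colour u} (λ w _ → label w)
    separates (u~w , _) (u~w' , _) eq with u-neighbour u~w | u-neighbour u~w'
    ... | inj₁ (_ , refl)         | inj₁ (_ , refl)          =
      cong (λ r → colour (base (bd r))) (d-index-injective eq)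
    ... | inj₁ (j₁ , refl)        | inj₂ (attached h _ _)    = ⊥-elim (u-supp-avoids-d j₁ h (sym eq))
    ... | inj₂ (attached h _ _)   | inj₁ (j₂ , refl)         = ⊥-elim (u-supp-avoids-d j₂ h eq)
    ... | inj₂ a@(attached _ _ _) | inj₂ a'@(attached _ _ _) = cong colour (attached-unique a a' eq)

  c-colour≥ : ∀ j → 2 * n + 3 ≤ colour (base (bc j))
  c-colour≥ j = ≮⇒≥ λ c<t → <-irrefl refl
    (window-labels {v = d} {t = t} (d-colour≥ j) ≤-refl (s≤s (m<m+n t (s≤s z≤n))) label
      (λ p → bounded (support c<t p)) (λ p p' → separates (support c<t p) (support c<t p')))
    where
    t = 2 * n + 3
    u = 2 * n + 3 + idx j
    d = base (bd j)
    label : Vertex φ → ℕ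
    label (sup _ s _ _) = s
    label (base _)      = 0
    support : colour (base (bc j)) < t → ∀ {w} → InWindow d t u w →
      Attached (bd j) w × t ≤ colour w × colour w < u
    support c<t (d~w , t≤w , w<u) with d-neighbour d~w
    ... | inj₁ refl        = ⊥-elim (<-asym w<u (<-≤-trans (d-index<pred-top j) u-near-top))
    ... | inj₂ (inj₁ refl) = ⊥-elim (<⇒≱ c<t t≤w)
    ... | inj₂ (inj₂ a)    = a , t≤w , w<u
    bounded : ∀ {w} → Attached (bd j) w × t ≤ colour w × colour w < u →
      suc t ≤ label w × label w < suc u × label w ≢ suc t
    bounded (a@(attached h _ _) , t≤w , w<u) =
      ≤-<-trans t≤w (attached-colour<size a (<-≤-trans w<u (d-colour≥ j))) , s≤s (proj₁ (supp-d h)) ,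
      λ eq → proj₂ (supp-d h) (trans eq (sym (+-suc (2 * n) 3)))
    separates : ∀ {w w'} → Attached (bd j) w × _ → Attached (bd j) w' × _ →
      label w ≡ label w' → colour w ≡ colour w'
    separates (a@(attached _ _ _) , _) (a'@(attached _ _ _) , _) eq = cong colour (attached-unique a a' eq)

  c-window : ∀ {j w} → base (bc j) ~ w → 2 * n ≤ colour w → colour w < 2 * n + 3 →
    ∃ λ q → w ≡ base (bx j q)
  c-window {j} c~w 2n≤w w<2n+3 with c-neighbour c~w
  ... | inj₁ refl                      = ⊥-elim (<⇒≱ w<2n+3 (≤-trans (m≤m+n _ _) (d-colour≥ j)))
  ... | inj₂ (inj₁ x)                  = x
  ... | inj₂ (inj₂ a@(attached h _ _)) = ⊥-elim (<⇒≱
    (<-≤-trans (attached-colour<size a (<-≤-trans w<2n+3 (c-colour≥ j))) (supp-c {j} h)) 2n≤w)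

  x-colour≥ : ∀ j p → 2 * n ≤ colour (base (bx j p))
  x-colour≥ j p = ≮⇒≥ λ x<2n → <-irrefl (m+n∸m≡n (2 * n) 3)
    (window-labels {v = c} {t = 2 * n} (c-colour≥ j) z≤n (toℕ<n p) label (bounded x<2n) separates)
    where
    c = base (bc j)
    label : Vertex φ → ℕ
    label (base (bx _ q)) = toℕ q
    label _               = 0
    bounded : colour (base (bx j p)) < 2 * n → ∀ {w} → InWindow c (2 * n) (2 * n + 3) w →
      0 ≤ label w × label w < 3 × label w ≢ toℕ p
    bounded x<2n (c~w , 2n≤w , w<) with c-window c~w 2n≤w w<
    ... | q , refl = z≤n , toℕ<n q ,
      λ eq → <⇒≱ x<2n (subst (λ r → 2 * n ≤ colour (base (bx j r))) (toℕ-injective eq) 2n≤w)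
    separates : Separating {c} {2 * n} {2 * n + 3} (λ w _ → label w)
    separates (c~w , l , h) (c~w' , l' , h') eq with c-window c~w l h | c-window c~w' l' h'
    ... | _ , refl | _ , refl = cong (λ r → colour (base (bx j r))) (toℕ-injective eq)

  clause-top-x : ∀ j → ∃ λ p → colour (base (bx j p)) ≡ 2 * n + 2
  clause-top-x j =
    let (w , c~w , w≡) = neighbour-of-colour (base (bc j)) (<-≤-trans 2n+2<2n+3 (c-colour≥ j))
        (p , w≡x)      = c-window c~w (subst (2 * n ≤_) (sym w≡) (m≤m+n _ 2))
                                      (subst (_< 2 * n + 3) (sym w≡) 2n+2<2n+3)
    in p , trans (cong colour (sym w≡x)) w≡

  literal-colour≤ : ∀ σ i → colour (base (literal σ i)) ≤ suc (2 * toℕ i)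
  literal-colour≤ σ i = ≮⇒≥ λ big →
    1+n≢n (trans (sym (opposite-colour (n≤1+n _) big (2i+2≤2n i)))
                 (opposite-colour ≤-refl (<-trans (n<1+n _) big) (≤-trans (n≤1+n _) (2i+2≤2n i))))
    where
    v = base (literal σ i)
    only-opposite : ∀ {w} → v ~ w → 2 * toℕ i ≤ colour w → colour w < colour v →
      colour w < 2 * n → w ≡ base (literal (not σ) i)
    only-opposite v~w 2i≤w w<v w<2n with literal-neighbour σ i v~w
    ... | inj₁ eq                        = eq
    ... | inj₂ (inj₁ (j , p , refl))     = ⊥-elim (<⇒≱ w<2n (x-colour≥ j p))
    ... | inj₂ (inj₂ a@(attached h _ _)) =
      ⊥-elim (<⇒≱ (<-≤-trans (attached-colour<size a w<v) (supp-literal σ i h)) 2i≤w)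
    opposite-colour : ∀ {c} → 2 * toℕ i ≤ c → c < colour v → c < 2 * n →
      colour (base (literal (not σ) i)) ≡ c
    opposite-colour 2i≤c c<v c<2n =
      let (w , v~w , w≡c) = neighbour-of-colour v c<v
          w≡opposite      = only-opposite v~w (subst (_ ≤_) (sym w≡c) 2i≤c)
                              (subst (_< _) (sym w≡c) c<v) (subst (_< _) (sym w≡c) c<2n)
      in trans (cong colour (sym w≡opposite)) w≡c

  x-label : Vertex φ → ℕ
  x-label (base (bxP i)) = suc (2 * toℕ i)
  x-label (base (bxN i)) = suc (2 * toℕ i)
  x-label (sup _ s _ _)  = s
  x-label _              = 0

  x-label-literal : ∀ σ i → x-label (base (literal σ i)) ≡ suc (2 * toℕ i)
  x-label-literal true  _ = refl
  x-label-literal false _ = refl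

  x-supp-avoids-later-literal : ∀ {j p s} i' → toℕ (proj₁ (φ j p)) < toℕ i' →
    T (supp φ (bx j p) s) → s ≢ suc (2 * toℕ i')
  x-supp-avoids-later-literal i' i<i' h s≡ with proj₂ (proj₂ (supp-x h)) (toℕ i') s≡
  ... | inj₁ i'≡i = <-irrefl (sym i'≡i) i<i'
  ... | inj₂ i'≡n = <-irrefl i'≡n (toℕ<n i')

  -- Below x_{i,j} the window [2i+1, 2n+2) can only be filled by literal vertices of the same
  -- sign with i' > i (label 2i'+1) and by support cliques (label = size); all these labels
  -- lie in [2i+3, 2n+2], one value short.
  literal-colour≥ : ∀ j p → colour (base (bx j p)) ≡ 2 * n + 2 →
    suc (2 * toℕ (proj₁ (φ j p))) ≤ colour (base (literal (proj₂ (φ j p)) (proj₁ (φ j p))))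
  literal-colour≥ j p x-top = ≮⇒≥ λ lit<t → <-irrefl refl
    (window-labels {v = x} {t = t} {lo = suc (suc t)} {hi = suc (suc u)} {e = suc u}
      (≤-reflexive (sym x-top)) (s≤s (≤-trans (2i+2≤2n i) (m≤m+n _ 2))) ≤-refl x-label
      (λ p → bounded (classify lit<t p)) (λ p p' → separates (classify lit<t p) (classify lit<t p')))
    where
    i = proj₁ (φ j p)
    σ = proj₂ (φ j p)
    x = base (bx j p)
    t = suc (2 * toℕ i)
    u = 2 * n + 2

    Classified : Vertex φ → Set
    Classified w = (∃ λ i' → toℕ i < toℕ i' × w ≡ base (literal σ i'))
                 ⊎ Attached (bx j p) w × t ≤ colour w × colour w < colour x

    classify : colour (base (literal σ i)) < t → ∀ {w} → InWindow x t u w → Classified w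
    classify lit<t (x~w , t≤w , w<u) with x-neighbour x~w
    ... | inj₁ refl               = ⊥-elim (<⇒≱ (<-trans w<u 2n+2<2n+3) (c-colour≥ j))
    ... | inj₂ (inj₂ a)           = inj₂ (a , t≤w , subst (_ <_) (sym x-top) w<u)
    ... | inj₂ (inj₁ (i' , refl)) = inj₁ (i' , ≤∧≢⇒< i≤i' i≢i' , refl)
      where
      i≤i' : toℕ i ≤ toℕ i'
      i≤i' = *-cancelˡ-≤ 2 (≤-pred (≤-trans t≤w (literal-colour≤ σ i')))
      i≢i' : toℕ i ≢ toℕ i'
      i≢i' eq =
        <⇒≱ lit<t (subst (λ r → t ≤ colour (base (literal σ r))) (sym (toℕ-injective eq)) t≤w)

    below-u : ∀ {ℓ} → ℓ ≤ u → ℓ < suc (suc u) × ℓ ≢ suc u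
    below-u ℓ≤u = m<n⇒m<1+n (s≤s ℓ≤u) , <⇒≢ (s≤s ℓ≤u)

    bounded : ∀ {w} → Classified w →
      suc (suc t) ≤ x-label w × x-label w < suc (suc u) × x-label w ≢ suc u
    bounded (inj₁ (i' , i<i' , refl)) rewrite x-label-literal σ i' =
      s≤s (subst (_≤ 2 * toℕ i') (*-suc 2 (toℕ i)) (*-monoʳ-≤ 2 i<i')) ,
      below-u (≤-trans (n≤1+n _) (≤-trans (2i+2≤2n i') (m≤m+n _ 2)))
    bounded (inj₂ (a@(attached h _ _) , t≤w , w<x)) =
      ≤∧≢⇒< (≤-<-trans t≤w (attached-colour<size a w<x))
            (λ eq → proj₁ (proj₂ (supp-x h)) (trans (sym eq) (sym (*-suc 2 (toℕ i))))) ,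
      below-u (proj₁ (supp-x h))

    separates : ∀ {w w'} → Classified w → Classified w' →
      x-label w ≡ x-label w' → colour w ≡ colour w'
    separates (inj₁ (i₁ , _ , refl)) (inj₁ (i₂ , _ , refl)) eq =
      cong (λ r → colour (base (literal σ r))) (toℕ-injective (*-cancelˡ-≡ _ _ 2 (suc-injective
        (trans (sym (x-label-literal σ i₁)) (trans eq (x-label-literal σ i₂))))))
    separates (inj₁ (i₁ , i<i₁ , refl)) (inj₂ (attached h _ _ , _)) eq =
      ⊥-elim (x-supp-avoids-later-literal i₁ i<i₁ h (trans (sym eq) (x-label-literal σ i₁)))
    separates (inj₂ (attached h _ _ , _)) (inj₁ (i₂ , i<i₂ , refl)) eq =
      ⊥-elim (x-supp-avoids-later-literal i₂ i<i₂ h (trans eq (x-label-literal σ i₂)))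
    separates (inj₂ (a@(attached _ _ _) , _)) (inj₂ (a'@(attached _ _ _) , _)) eq =
      cong colour (attached-unique a a' eq)

  assignment : Fin n → Bool
  assignment i = does (suc (2 * toℕ i) ≤? colour (base (bxP i)))

  assignment-agrees : ∀ σ i → suc (2 * toℕ i) ≤ colour (base (literal σ i)) → assignment i ≡ σ
  assignment-agrees true  i P-high = dec-true (_ ≤? _) P-high
  assignment-agrees false i N-high = dec-false (_ ≤? _) λ P-high →
    proper (base (bxP i)) (base (bxN i)) (inj₁ (e-PN i)) (toℕ-injective
      (trans (≤-antisym (literal-colour≤ true i) P-high)
             (sym (≤-antisym (literal-colour≤ false i) N-high))))

  satisfiable : Satisfiable φ
  satisfiable = assignment , λ j →
    let (p , x-top) = clause-top-x j in p , assignment-agrees _ _ (literal-colour≥ j p x-top)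

-- The argument never uses that the three variables of a clause are distinct.
lemma5p3 : (n m : ℕ) (φ : Formula n m) → ThreeVars φ →
           GrundyColoring (G φ) (10 * n + 10 * m + 1) → Satisfiable φ
lemma5p3 n       zero    φ _ _  = (λ _ → true) , λ ()
lemma5p3 zero    (suc m) φ _ _  with proj₁ (φ fzero fzero)
... | ()
lemma5p3 (suc n) (suc m) φ _ gc = Colouring.satisfiable n m φ gc
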